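{- Let $p$ be a prime, $k\ge1$, and let $G=(V,E)$ be a connected graph with vertices ordered $v_1,\dots,v_n$ and edge-labeling $\alpha:E\to\{\text{ideals of }\mathbb{Z}/p^k\mathbb{Z}\}$. Let $\mathbf{b}^{(i)},\mathbf{b}^{(j)}$ be splines in the minimum generating set $\mathbb{B}_{p^k}$ described in the context, such that the nonzero entries of $\mathbf{b}^{(i)}$ are $p^s$ and those of $\mathbf{b}^{(j)}$ are $p^r$, where $s\le r<k$. Then (with entrywise multiplication) \[\mathbf{b}^{(i)}\mathbf{b}^{(j)}=\begin{cases}p^s\,\mathbf{b}^{(j)}&\text{if }\operatorname{supp}(\mathbf{b}^{(i)})\cap\operatorname{supp}(\mathbf{b}^{(j)})\neq\emptyset\text{ and }s+r<k,\\ \mathbf{0}&\text{if }\operatorname{supp}(\mathbf{b}^{(i)})\cap\operatorname{supp}(\mathbf{b}^{(j)})\neq\emptyset\text{ and }s+r\ge k,\\ \mathbf{0}&\text{if }\operatorname{supp}(\mathbf{b}^{(i)})\cap\operatorname{supp}(\mathbf{b}^{(j)})=\emptyset.\end{cases}\]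
   Context: For a commutative ring $R$, a finite connected graph $G$ and an edge-labeling $\alpha$ assigning to each edge an ideal of $R$, a spline is $\mathbf{f}\in R^{|V|}$ with $\mathbf{f}_u-\mathbf{f}_v\in\alpha(uv)$ for every edge $uv$; splines form a ring under entrywise operations. The support $\operatorname{supp}(\mathbf{f})$ of a spline is the set of vertices where it is nonzero. For $1\le\gamma\le k$, $\alpha_\gamma$ is the reduction of $\alpha$ via $\mathbb{Z}/p^k\mathbb{Z}\to\mathbb{Z}/p^\gamma\mathbb{Z}$; a zero-connected component of $(G,\alpha_\gamma)$ is a class of vertices joined by paths of edges whose label is the zero ideal; $V^{(i,\gamma)}$ is the zero-connected component of $(G,\alpha_\gamma)$ with smallest-index vertex $v_i$, and $I_\gamma$ is the set of such indices ($I_0=\emptyset$). $\mathbb{B}_{p^k}$ consists of, for each $1\le\gamma\le k$ and each $i\in I_\gamma\setminus I_{\gamma-1}$, the spline over $\mathbb{Z}/p^k\mathbb{Z}$ with value $p^{\gamma-1}$ on $V^{(i,\gamma)}$ and $0$ elsewhere. -}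

module Defs where

open import Data.Nat using (ℕ; zero; suc; _+_; _*_; _∸_; _^_; _≤_; _<_)
open import Data.Nat.Divisibility using (_∣_)
open import Data.Fin using (Fin; toℕ)
open import Data.List using (List)
open import Data.List.Membership.Propositional using (_∈_)
open import Data.Product using (_×_; _,_; ∃; ∃-syntax)
open import Data.Sum using (_⊎_)
open import Data.Empty using (⊥)
open import Relation.Nullary using (¬_)
open import Relation.Binary.PropositionalEquality using (_≡_)
open import Relation.Binary.Construct.Closure.ReflexiveTransitive using (Star)

infix 4 _≡_[mod_]
_≡_[mod_] : ℕ → ℕ → ℕ → Set
a ≡ b [mod m ] = ∃[ x ] ∃[ y ] (a + x * m ≡ b + y * m)

-- An edge-labelled finite graph on vertices v_1..v_n (= Fin n, ordered by toℕ).
-- Edges are given as a list of vertex pairs; the label of an edge e is the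
-- ideal of ℤ/p^kℤ generated by (the class of) label e.  Every ideal of
-- ℤ/p^kℤ is principal, so this covers every edge-labeling.
record EGraph (n : ℕ) : Set where
  field
    edges : List (Fin n × Fin n)
    label : Fin n × Fin n → ℕ
open EGraph public

Adj : ∀ {n} → EGraph n → Fin n → Fin n → Set
Adj G u v = ((u , v) ∈ edges G) ⊎ ((v , u) ∈ edges G)

Connected : ∀ {n} → EGraph n → Set
Connected G = ∀ u v → Star (Adj G) u v

-- u, v are joined by an edge whose label, reduced along ℤ/p^kℤ → ℤ/p^γℤ,
-- is the zero ideal; the image of ⟨a⟩ is ⟨a mod p^γ⟩, zero iff p^γ ∣ a.
ZeroAdj : ∀ {n} → ℕ → EGraph n → ℕ → Fin n → Fin n → Set
ZeroAdj p G γ u v =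
  (((u , v) ∈ edges G) × (p ^ γ ∣ label G (u , v)))
  ⊎ (((v , u) ∈ edges G) × (p ^ γ ∣ label G (v , u)))

ZeroConn : ∀ {n} → ℕ → EGraph n → ℕ → Fin n → Fin n → Set
ZeroConn p G γ = Star (ZeroAdj p G γ)

InI : ∀ {n} → ℕ → EGraph n → ℕ → Fin n → Set
InI p G zero i = ⊥
InI p G (suc γ) i = ∀ j → ZeroConn p G (suc γ) i j → toℕ i ≤ toℕ j

InIdiff : ∀ {n} → ℕ → EGraph n → ℕ → Fin n → Set
InIdiff p G γ i = InI p G γ i × ¬ InI p G (γ ∸ 1) i

IsBasisSpline : ∀ {n} → ℕ → EGraph n → ℕ → Fin n → (Fin n → ℕ) → Set
IsBasisSpline p G γ i b =
  ∀ v → (ZeroConn p G γ i v → b v ≡ p ^ (γ ∸ 1))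
      × (¬ ZeroConn p G γ i v → b v ≡ 0)

InSupp : ∀ {n} → ℕ → ℕ → (Fin n → ℕ) → Fin n → Set
InSupp p k f v = ¬ (p ^ k ∣ f v)

SuppMeet : ∀ {n} → ℕ → ℕ → (Fin n → ℕ) → (Fin n → ℕ) → Set
SuppMeet p k f g = ∃[ v ] (InSupp p k f v × InSupp p k g v)

module Submission where

open import Defs
open import Data.Nat using (ℕ; _+_; _*_; _^_; _≤_; _<_)
open import Data.Nat.Primality using (Prime)
open import Data.Fin using (Fin)
open import Data.Product using (_×_)
open import Relation.Nullary using (¬_)

open import Data.Nat using (zero; suc; _≟_; _%_; >-nonZero; s≤s; nonTrivial⇒n>1)
open import Data.Nat.Properties
  using (+-identityʳ; *-identityʳ; *-zeroʳ; <⇒≱; <⇒≢; ≤-<-trans; m^n>0; ^-monoʳ-<; ^-distribˡ-+-*)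
open import Data.Nat.DivMod using (m<n⇒m%n≡m; [m+kn]%n≡m%n)
open import Data.Nat.Divisibility
  using (_∣_; divides; _∣?_; _∣0; ∣-trans; ∣⇒≤; *-monoʳ-∣; m∣m*n; n∣m*n)
open import Data.Nat.Primality using (prime)
open import Data.Empty using (⊥-elim)
open import Data.Product using (_,_; proj₁; proj₂)
open import Data.Sum using (_⊎_; inj₁; inj₂)
open import Relation.Nullary using (yes; no)
open import Relation.Nullary.Decidable using (decidable-stable)
open import Relation.Binary.PropositionalEquality
  using (_≡_; _≢_; refl; sym; trans; cong; subst; subst₂; module ≡-Reasoning)
open import Relation.Binary.Construct.Closure.ReflexiveTransitive
  using (ε; _◅◅_; reverse; map)

-- A basis spline b ∈ 𝔹_{p^k} with index (γ, i) is a scaled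
-- indicator vector: it equals p^(γ-1) on the zero-connected component
-- V^(i,γ) and 0 off it.  Evaluating at v_i, where p^(γ-1) is nonzero mod
-- p^k, identifies the scale with p^s; likewise p^(δ-1) = p^r.  Then:
--   * if supp b^(i) ∩ supp b^(j) = ∅, at every vertex one factor is 0 mod
--     p^k, so the product vanishes (this holds for arbitrary vectors);
--   * if k ≤ s + r, every entry of the product is 0 or p^s p^r = p^(s+r);
--   * if the supports meet, then p^γ ∣ p^δ (as p^(γ-1) = p^s ∣ p^r =
--     p^(δ-1)), so every edge zero at level δ is zero at level γ and
--     V^(j,δ) lies inside V^(i,γ); hence b^(i) = p^s wherever
--     b^(j) ≠ 0, i.e. b^(i) b^(j) = p^s b^(j).
-- Zero-connectivity is not decidable, so membership and inclusion are only
-- obtained up to double negation; this suffices because the entries of the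
-- vectors have decidable equality.

≡⇒≡[mod] : ∀ {a b} m → a ≡ b → a ≡ b [mod m ]
≡⇒≡[mod] m refl = 0 , 0 , refl

∣⇒≡0[mod] : ∀ {m c} → m ∣ c → c ≡ 0 [mod m ]
∣⇒≡0[mod] {c = c} (divides q eq) = 0 , q , trans (+-identityʳ c) eq

≡[mod]⇒≡ : ∀ {a b m} → a < m → b < m → a ≡ b [mod m ] → a ≡ b
≡[mod]⇒≡ {a} {b} {suc m} a<m b<m (x , y , eq) = begin
  a                       ≡⟨ sym (m<n⇒m%n≡m a<m) ⟩
  a % suc m               ≡⟨ sym ([m+kn]%n≡m%n a x (suc m)) ⟩
  (a + x * suc m) % suc m ≡⟨ cong (_% suc m) eq ⟩
  (b + y * suc m) % suc m ≡⟨ [m+kn]%n≡m%n b y (suc m) ⟩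
  b % suc m               ≡⟨ m<n⇒m%n≡m b<m ⟩
  b                       ∎
  where open ≡-Reasoning

∤-small : ∀ {a m} → 0 < a → a < m → ¬ m ∣ a
∤-small {a} 0<a a<m m∣a = <⇒≱ a<m (∣⇒≤ {{>-nonZero 0<a}} m∣a)

-- If not both factors are nonzero modulo m, then m divides the product
-- (De Morgan is valid here because divisibility is decidable).
∣-product : ∀ {m} a b → ¬ (¬ m ∣ a × ¬ m ∣ b) → m ∣ a * b
∣-product {m} a b not-both with m ∣? a | m ∣? b
... | yes m∣a | _       = ∣-trans m∣a (m∣m*n b)
... | no _    | yes m∣b = ∣-trans m∣b (n∣m*n a)
... | no m∤a  | no m∤b  = ⊥-elim (not-both (m∤a , m∤b))

^-∣-mono : ∀ p {s r} → s ≤ r → p ^ s ∣ p ^ r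
^-∣-mono p {zero}  {r}     _         = divides (p ^ r) (sym (*-identityʳ (p ^ r)))
^-∣-mono p {suc s} {suc r} (s≤s s≤r) = *-monoʳ-∣ p (^-∣-mono p s≤r)

^-positive : ∀ {p} → 1 < p → ∀ x → 0 < p ^ x
^-positive {p@(suc _)} _ x = m^n>0 p x

ZeroAdj-sym : ∀ {n p γ} {G : EGraph n} {u v} →
  ZeroAdj p G γ u v → ZeroAdj p G γ v u
ZeroAdj-sym (inj₁ e) = inj₂ e
ZeroAdj-sym (inj₂ e) = inj₁ e

ZeroAdj-coarsen : ∀ {n p γ δ} {G : EGraph n} → p ^ γ ∣ p ^ δ → ∀ {u v} →
  ZeroAdj p G δ u v → ZeroAdj p G γ u v
ZeroAdj-coarsen d (inj₁ (e , x)) = inj₁ (e , ∣-trans d x)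
ZeroAdj-coarsen d (inj₂ (e , x)) = inj₂ (e , ∣-trans d x)

ZeroConn-nested : ∀ {n p γ δ} {G : EGraph n} → p ^ γ ∣ p ^ δ → ∀ {i j w v} →
  ZeroConn p G γ i w → ZeroConn p G δ j w →
  ZeroConn p G δ j v → ZeroConn p G γ i v
ZeroConn-nested {p = p} {γ} {δ} {G} d i~w j~w j~v =
  i~w ◅◅ map (ZeroAdj-coarsen {p = p} {γ} {δ} {G} d)
             (reverse (ZeroAdj-sym {p = p} {δ} {G}) j~w ◅◅ j~v)

-- b = c · 1_C: b takes the value c on C and 0 off C.  A basis spline of
-- index (γ, i) is, by definition, the scaled indicator of V^(i,γ) with
-- scale p^(γ-1).
ScaledIndicator : ∀ {n} → (Fin n → Set) → ℕ → (Fin n → ℕ) → Set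
ScaledIndicator C c b = ∀ v → (C v → b v ≡ c) × (¬ C v → b v ≡ 0)

module _ {n} {C : Fin n → Set} {c} {b : Fin n → ℕ} (ind : ScaledIndicator C c b) where

  nonzero⇒on : ∀ {v} → b v ≢ 0 → ¬ ¬ C v
  nonzero⇒on b≢0 ∉C = b≢0 (proj₂ (ind _) ∉C)

  -- On C the entries equal c; decidability of ℕ-equality removes ¬¬.
  on⇒scale : ∀ {v} → ¬ ¬ C v → b v ≡ c
  on⇒scale {v} ¬¬∈C = decidable-stable (b v ≟ c) (λ b≢c → ¬¬∈C (λ ∈C → b≢c (proj₁ (ind v) ∈C)))

  two-valued : ∀ v → b v ≡ 0 ⊎ b v ≡ c
  two-valued v with b v ≟ 0
  ... | yes b≡0 = inj₁ b≡0
  ... | no  b≢0 = inj₂ (on⇒scale (nonzero⇒on b≢0))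

  support⇒on : ∀ {m v} → ¬ m ∣ b v → ¬ ¬ C v
  support⇒on {m} m∤b ∉C = m∤b (subst (m ∣_) (sym (proj₂ (ind _) ∉C)) (m ∣0))

  scale-unique : ∀ {m c′ x} → C x → 0 < c → c < m → c′ < m →
    (∀ v → ¬ m ∣ b v → b v ≡ c′ [mod m ]) → c ≡ c′
  scale-unique {m} {c′} {x} ∈C 0<c c<m c′<m value =
    ≡[mod]⇒≡ c<m c′<m (subst (λ t → t ≡ c′ [mod m ]) b≡c (value x m∤b))
    where
    b≡c : b x ≡ c
    b≡c = proj₁ (ind x) ∈C
    m∤b : ¬ m ∣ b x
    m∤b = subst (λ t → ¬ m ∣ t) (sym b≡c) (∤-small 0<c c<m)

module _ {n} {C C′ : Fin n → Set} {c c′} {b b′ : Fin n → ℕ}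
         (ind : ScaledIndicator C c b) (ind′ : ScaledIndicator C′ c′ b′) where

  -- If C′ ⊆ C (up to ¬¬) and c′ ≠ 0, then b · b′ = c · b′: wherever b′ is
  -- nonzero we are on C′, hence on C, where b equals c.
  product-nested : 0 < c′ → (∀ v → C′ v → ¬ ¬ C v) → ∀ v → b v * b′ v ≡ c * b′ v
  product-nested 0<c′ C′⊆C v with two-valued ind′ v
  ... | inj₁ b′≡0 rewrite b′≡0 | *-zeroʳ (b v) | *-zeroʳ c = refl
  ... | inj₂ b′≡c′ = cong (_* b′ v) (on⇒scale ind on-C)
    where
    on-C′ : ¬ ¬ C′ v
    on-C′ = nonzero⇒on ind′ (λ b′≡0 → <⇒≢ 0<c′ (trans (sym b′≡0) b′≡c′))
    on-C : ¬ ¬ C v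
    on-C ∉C = on-C′ (λ ∈C′ → C′⊆C v ∈C′ ∉C)

  -- Every entry of b · b′ is 0 or c · c′, so m divides all of them as soon
  -- as m divides c · c′.
  product-vanishes : ∀ {m} → m ∣ c * c′ → ∀ v → m ∣ b v * b′ v
  product-vanishes {m} m∣cc′ v with two-valued ind v | two-valued ind′ v
  ... | inj₁ b≡0  | _          rewrite b≡0 = m ∣0
  ... | inj₂ _    | inj₁ b′≡0  rewrite b′≡0 | *-zeroʳ (b v) = m ∣0
  ... | inj₂ b≡c  | inj₂ b′≡c′ rewrite b≡c | b′≡c′ = m∣cc′

-- The scale of a basis spline of index (γ + 1, i) is read off at v_i, where
-- p^γ is nonzero mod p^k: it equals the common value p^s of its support.
basis-scale : ∀ {n p k γ s} {G : EGraph n} {i b} → 1 < p →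
  IsBasisSpline p G (suc γ) i b → γ < k → s < k →
  (∀ v → InSupp p k b v → b v ≡ p ^ s [mod p ^ k ]) → p ^ γ ≡ p ^ s
basis-scale {p = p} {γ = γ} 1<p B γ<k s<k value =
  scale-unique B ε (^-positive 1<p γ) (^-monoʳ-< p 1<p γ<k) (^-monoʳ-< p 1<p s<k) value

supports-meet⇒nested : ∀ {n p k γ δ} {G : EGraph n} {i j bi bj} →
  p ^ γ ∣ p ^ δ → IsBasisSpline p G γ i bi → IsBasisSpline p G δ j bj →
  SuppMeet p k bi bj → ∀ v → ZeroConn p G δ j v → ¬ ¬ ZeroConn p G γ i v
supports-meet⇒nested {p = p} {γ = γ} {δ} {G} d Bi Bj (w , w∈supp-i , w∈supp-j) v j~v i≁v =
  support⇒on Bi w∈supp-i (λ i~w →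
  support⇒on Bj w∈supp-j (λ j~w →
  i≁v (ZeroConn-nested {p = p} {γ} {δ} {G} d i~w j~w j~v)))

theorem5p5 : (p : ℕ) → Prime p → (k : ℕ) → 1 ≤ k →
    (n : ℕ) → (G : EGraph n) → Connected G →
    (γ δ : ℕ) → (i j : Fin n) → (bi bj : Fin n → ℕ) →
    1 ≤ γ → γ ≤ k → InIdiff p G γ i → IsBasisSpline p G γ i bi →
    1 ≤ δ → δ ≤ k → InIdiff p G δ j → IsBasisSpline p G δ j bj →
    (s r : ℕ) →
    (∀ v → InSupp p k bi v → bi v ≡ p ^ s [mod p ^ k ]) →
    (∀ v → InSupp p k bj v → bj v ≡ p ^ r [mod p ^ k ]) →
    s ≤ r → r < k →
    ((SuppMeet p k bi bj → s + r < k →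
        ∀ v → bi v * bj v ≡ p ^ s * bj v [mod p ^ k ])
    × (SuppMeet p k bi bj → k ≤ s + r →
        ∀ v → bi v * bj v ≡ 0 [mod p ^ k ])
    × (¬ SuppMeet p k bi bj →
        ∀ v → bi v * bj v ≡ 0 [mod p ^ k ]))
theorem5p5 p (prime _) k _ n G _ (suc γ) (suc δ) i j bi bj
    _ γ<k _ Bi _ δ<k _ Bj s r value-i value-j s≤r r<k =
    (λ meet _ v → ≡⇒≡[mod] (p ^ k)
        (product-nested Bi′ Bj′ (^-positive 1<p r) (component-j⊆i meet) v))
  , (λ _ k≤s+r v → ∣⇒≡0[mod] (product-vanishes Bi′ Bj′ (p^k∣p^s*p^r k≤s+r) v))
  , (λ disjoint v → ∣⇒≡0[mod] (∣-product (bi v) (bj v) (λ both → disjoint (v , both))))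
  where
  1<p : 1 < p
  1<p = nonTrivial⇒n>1 p
  scale-i : p ^ γ ≡ p ^ s
  scale-i = basis-scale 1<p Bi γ<k (≤-<-trans s≤r r<k) value-i
  scale-j : p ^ δ ≡ p ^ r
  scale-j = basis-scale 1<p Bj δ<k r<k value-j
  Bi′ : ScaledIndicator (ZeroConn p G (suc γ) i) (p ^ s) bi
  Bi′ = subst (λ c → ScaledIndicator (ZeroConn p G (suc γ) i) c bi) scale-i Bi
  Bj′ : ScaledIndicator (ZeroConn p G (suc δ) j) (p ^ r) bj
  Bj′ = subst (λ c → ScaledIndicator (ZeroConn p G (suc δ) j) c bj) scale-j Bj
  -- p^γ = p^s ∣ p^r = p^δ, so components at level δ+1 refine those at level γ+1
  p^γ∣p^δ : p ^ suc γ ∣ p ^ suc δ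
  p^γ∣p^δ = *-monoʳ-∣ p (subst₂ _∣_ (sym scale-i) (sym scale-j) (^-∣-mono p s≤r))
  component-j⊆i : SuppMeet p k bi bj →
    ∀ v → ZeroConn p G (suc δ) j v → ¬ ¬ ZeroConn p G (suc γ) i v
  component-j⊆i = supports-meet⇒nested {p = p} {k} {suc γ} {suc δ} {G} p^γ∣p^δ Bi Bj
  p^k∣p^s*p^r : k ≤ s + r → p ^ k ∣ p ^ s * p ^ r
  p^k∣p^s*p^r k≤s+r = subst (p ^ k ∣_) (^-distribˡ-+-* p s r) (^-∣-mono p k≤s+r)
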